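{- Let $L$ be a finite geometric lattice. Then every sub-$M$-chain of $L$ is an $M$-chain. Consequently, a finite lattice is geometric and comodernistic if and only if it is geometric and supersolvable.
   Context: An element $m$ of a lattice $L$ is left-modular if $(x\vee m)\wedge y=x\vee(m\wedge y)$ for all $x<y$ in $L$. An $M$-chain is a maximal chain of $L$ all of whose elements are left-modular in $L$; a lattice is supersolvable if it is graded and has an $M$-chain. A sub-$M$-chain is a maximal chain $\hat0=m_0\lessdot m_1\lessdot\cdots\lessdot m_n=\hat1$ such that each $m_i$ is left-modular in the interval $[\hat0,m_{i+1}]$. A lattice is comodernistic if every interval $[u,v]$ has a coatom that is left-modular in $[u,v]$. A geometric lattice is a semimodular atomistic lattice. -}

module Defs where

open import Level using (Level; _⊔_)
open import Data.Nat using (ℕ; suc)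
open import Data.Fin using (Fin; zero; fromℕ; inject₁)
open import Data.Fin as F using ()
open import Data.List using (List; foldr)
open import Data.List.Relation.Unary.All using (All)
open import Data.Product using (Σ; ∃; _×_; _,_)
open import Relation.Nullary using (¬_)
open import Relation.Binary.Definitions using (Decidable)
open import Relation.Binary.PropositionalEquality using (_≡_)
open import Relation.Binary.Lattice.Bundles using (BoundedLattice)

module _ {c ℓ₁ ℓ₂ : Level} (L : BoundedLattice c ℓ₁ ℓ₂) where
  open BoundedLattice L

  -- Finiteness: the carrier is enumerated (up to ≈) by some Fin n,
  -- and the order is decidable (automatic classically for finite posets).
  IsFinite : Set (c ⊔ ℓ₁ ⊔ ℓ₂)
  IsFinite = Σ ℕ λ n → Σ (Fin n → Carrier) λ enum →
               (∀ x → ∃ λ i → enum i ≈ x) × Decidable _≤_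

  _<ₗ_ : Carrier → Carrier → Set (ℓ₁ ⊔ ℓ₂)
  x <ₗ y = x ≤ y × ¬ (x ≈ y)

  _⋖_ : Carrier → Carrier → Set (c ⊔ ℓ₁ ⊔ ℓ₂)
  x ⋖ y = x <ₗ y × (∀ z → x <ₗ z → ¬ (z <ₗ y))

  LeftModular : Carrier → Set (c ⊔ ℓ₁ ⊔ ℓ₂)
  LeftModular m = ∀ x y → x <ₗ y → ((x ∨ m) ∧ y) ≈ (x ∨ (m ∧ y))

  -- m is left-modular in the interval [u,v] (joins/meets of [u,v] are those of L)
  LeftModularIn : Carrier → Carrier → Carrier → Set (c ⊔ ℓ₁ ⊔ ℓ₂)
  LeftModularIn u v m = ∀ x y → u ≤ x → y ≤ v → x <ₗ y →
                          ((x ∨ m) ∧ y) ≈ (x ∨ (m ∧ y))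

  MaxChain : ℕ → Set (c ⊔ ℓ₁ ⊔ ℓ₂)
  MaxChain n = Σ (Fin (suc n) → Carrier) λ m →
                 (m zero ≈ ⊥) × (m (fromℕ n) ≈ ⊤) ×
                 (∀ (i : Fin n) → m (inject₁ i) ⋖ m (F.suc i))

  IsMChain : {n : ℕ} → MaxChain n → Set (c ⊔ ℓ₁ ⊔ ℓ₂)
  IsMChain (m , _) = ∀ i → LeftModular (m i)

  IsSubMChain : {n : ℕ} → MaxChain n → Set (c ⊔ ℓ₁ ⊔ ℓ₂)
  IsSubMChain {n} (m , _) = ∀ (i : Fin n) → LeftModularIn ⊥ (m (F.suc i)) (m (inject₁ i))

  Graded : Set (c ⊔ ℓ₁ ⊔ ℓ₂)
  Graded = ∀ n k → MaxChain n → MaxChain k → n ≡ k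

  Supersolvable : Set (c ⊔ ℓ₁ ⊔ ℓ₂)
  Supersolvable = Graded × Σ ℕ λ n → Σ (MaxChain n) IsMChain

  Comodernistic : Set (c ⊔ ℓ₁ ⊔ ℓ₂)
  Comodernistic = ∀ u v → u <ₗ v →
                    ∃ λ m → u ≤ m × m ⋖ v × LeftModularIn u v m

  Semimodular : Set (c ⊔ ℓ₁ ⊔ ℓ₂)
  Semimodular = ∀ x y → (x ∧ y) ⋖ x → y ⋖ (x ∨ y)

  IsAtom : Carrier → Set (c ⊔ ℓ₁ ⊔ ℓ₂)
  IsAtom a = ⊥ ⋖ a

  Atomistic : Set (c ⊔ ℓ₁ ⊔ ℓ₂)
  Atomistic = ∀ x → ∃ λ (as : List Carrier) → All IsAtom as × (foldr _∨_ ⊥ as ≈ x)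

  Geometric : Set (c ⊔ ℓ₁ ⊔ ℓ₂)
  Geometric = Semimodular × Atomistic

module Submission where

-- The key step: if M is left-modular in L, m ⋖ M, and m is left-modular in [⊥, M], then m is
-- left-modular in L.  Given x ≤ y, either M ≰ x ∨ m, so (x ∨ m) ∧ M = m and the left-modularity
-- of M alone yields (x ∨ m) ∧ y ≤ x ∨ (m ∧ y); or M ≤ x ∨ m, and then x ∧ M ≰ m (climbing from
-- x ∧ M to x along a maximal chain, semimodularity and left-modularity of M never let m ∨ s
-- reach M), so (x ∧ M) ∨ m = M and the inequality comes from left-modularity of m in [⊥, M].
-- Walking down a sub-M-chain from ⊤ gives the first claim.  In a comodernistic lattice, choosing
-- left-modular coatoms from ⊤ downwards builds such a chain.  Conversely, the projections
-- (u ∨ mᵢ) ∧ v of an M-chain climb from u to v in [u, v], and the last one below v is a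
-- left-modular coatom of [u, v].  Gradedness is Jordan–Dedekind for semimodular lattices.
-- Finiteness is used only through decidability of ≤: every induction runs along finite chains.

open import Defs
  using (IsFinite; MaxChain; IsMChain; IsSubMChain; Graded; Supersolvable; Comodernistic;
         Semimodular; Atomistic; Geometric)
open import Relation.Binary.Lattice.Bundles using (BoundedLattice)

open import Level using (_⊔_)
open import Data.Nat using (ℕ; zero; suc)
open import Data.Fin using (Fin; zero; suc; fromℕ; inject₁)
open import Data.List using (_∷_; foldr)
open import Data.List.Relation.Unary.All using (All; []; _∷_)
open import Data.Product using (Σ; ∃; _×_; _,_; proj₂)
open import Data.Sum using (_⊎_; inj₁; inj₂)
open import Data.Empty using (⊥-elim)
open import Function using (_∘_)
open import Relation.Nullary using (¬_; yes; no)
open import Relation.Binary.Definitions using (Decidable)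
open import Relation.Binary.PropositionalEquality as ≡ using (_≡_)
import Relation.Binary.Lattice.Properties.JoinSemilattice as JoinSemilatticeProperties
import Relation.Binary.Lattice.Properties.MeetSemilattice as MeetSemilatticeProperties
import Relation.Binary.Lattice.Properties.BoundedJoinSemilattice as BoundedJoinSemilatticeProperties
import Relation.Binary.Reasoning.PartialOrder as PosetReasoning

module DecidableBoundedLattice {c ℓ₁ ℓ₂} (L : BoundedLattice c ℓ₁ ℓ₂)
                               (_≤?_ : Decidable (BoundedLattice._≤_ L)) where

  open BoundedLattice L
  open JoinSemilatticeProperties joinSemilattice using (∨-monotonic; ∨-cong; ∨-comm; x≤y⇒x∨y≈y)
  open MeetSemilatticeProperties meetSemilattice using (∧-monotonic; ∧-cong)
  open BoundedJoinSemilatticeProperties boundedJoinSemilattice using (identityʳ)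
  open PosetReasoning poset

  infix 4 _<ₗ_ _⋖_

  _<ₗ_ : Carrier → Carrier → Set (ℓ₁ ⊔ ℓ₂)
  _<ₗ_ = Defs._<ₗ_ L

  _⋖_ : Carrier → Carrier → Set (c ⊔ ℓ₁ ⊔ ℓ₂)
  _⋖_ = Defs._⋖_ L

  LeftModular : Carrier → Set (c ⊔ ℓ₁ ⊔ ℓ₂)
  LeftModular = Defs.LeftModular L

  LeftModularIn : Carrier → Carrier → Carrier → Set (c ⊔ ℓ₁ ⊔ ℓ₂)
  LeftModularIn = Defs.LeftModularIn L

  IsAtom : Carrier → Set (c ⊔ ℓ₁ ⊔ ℓ₂)
  IsAtom = Defs.IsAtom L

  private
    variable
      a b m m′ p p′ q q′ r s t u v x x′ y y′ z M : Carrier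
      k n : ℕ

  infix 4 _≈?_
  _≈?_ : Decidable _≈_
  x ≈? y with x ≤? y | y ≤? x
  ... | yes x≤y | yes y≤x = yes (antisym x≤y y≤x)
  ... | no x≰y  | _       = no (x≰y ∘ reflexive)
  ... | yes _   | no y≰x  = no (y≰x ∘ reflexive ∘ Eq.sym)

  ⋖⇒≤ : x ⋖ y → x ≤ y
  ⋖⇒≤ ((x≤y , _) , _) = x≤y

  ⋖⇒≉ : x ⋖ y → ¬ x ≈ y
  ⋖⇒≉ ((_ , x≉y) , _) = x≉y

  ⋖-respˡ-≈ : x ≈ x′ → x ⋖ y → x′ ⋖ y
  ⋖-respˡ-≈ x≈x′ ((x≤y , x≉y) , tight) =
    (trans (reflexive (Eq.sym x≈x′)) x≤y , x≉y ∘ Eq.trans x≈x′) ,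
    λ z (x′≤z , x′≉z) → tight z (trans (reflexive x≈x′) x′≤z , x′≉z ∘ Eq.trans (Eq.sym x≈x′))

  ⋖-respʳ-≈ : y ≈ y′ → x ⋖ y → x ⋖ y′
  ⋖-respʳ-≈ y≈y′ ((x≤y , x≉y) , tight) =
    (trans x≤y (reflexive y≈y′) , λ x≈y′ → x≉y (Eq.trans x≈y′ (Eq.sym y≈y′))) ,
    λ z x<z (z≤y′ , z≉y′) → tight z x<z (trans z≤y′ (reflexive (Eq.sym y≈y′)) , λ z≈y → z≉y′ (Eq.trans z≈y y≈y′))

  ⋖-between : x ⋖ y → x ≤ z → z ≤ y → z ≈ x ⊎ z ≈ y
  ⋖-between {x} {y} {z} (_ , tight) x≤z z≤y with z ≈? x | z ≈? y
  ... | yes z≈x | _       = inj₁ z≈x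
  ... | no _    | yes z≈y = inj₂ z≈y
  ... | no z≉x  | no z≉y  = ⊥-elim (tight z (x≤z , z≉x ∘ Eq.sym) (z≤y , z≉y))

  ⋖-intro : x <ₗ y → (∀ {z} → x ≤ z → z ≤ y → z ≤ x ⊎ y ≤ z) → x ⋖ y
  ⋖-intro {x} {y} x<y collapse = x<y , nothing-between
    where
    nothing-between : ∀ z → x <ₗ z → ¬ z <ₗ y
    nothing-between z (x≤z , x≉z) (z≤y , z≉y) with collapse x≤z z≤y
    ... | inj₁ z≤x = x≉z (antisym x≤z z≤x)
    ... | inj₂ y≤z = z≉y (antisym z≤y y≤z)

  ⋖-meet : p ⋖ a → p ⋖ b → ¬ a ≈ b → a ∧ b ≈ p
  ⋖-meet {p} {a} {b} p⋖a p⋖b a≉b with ⋖-between p⋖a (∧-greatest (⋖⇒≤ p⋖a) (⋖⇒≤ p⋖b)) (x∧y≤x a b)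
  ... | inj₁ a∧b≈p = a∧b≈p
  ... | inj₂ a∧b≈a with ⋖-between p⋖b (⋖⇒≤ p⋖a) (trans (reflexive (Eq.sym a∧b≈a)) (x∧y≤y a b))
  ...   | inj₁ a≈p = ⊥-elim (⋖⇒≉ p⋖a (Eq.sym a≈p))
  ...   | inj₂ a≈b = ⊥-elim (a≉b a≈b)

  LeftModularAt : Carrier → Carrier → Carrier → Set ℓ₂
  LeftModularAt m x y = (x ∨ m) ∧ y ≤ x ∨ (m ∧ y)

  modular-inequality : ∀ m → x ≤ y → x ∨ (m ∧ y) ≤ (x ∨ m) ∧ y
  modular-inequality {x} {y} m x≤y = ∧-greatest (∨-monotonic refl (x∧y≤x m y)) (∨-least x≤y (x∧y≤y m y))

  at⇒leftModular : (∀ {x y} → x ≤ y → LeftModularAt m x y) → LeftModular m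
  at⇒leftModular {m} bound x y (x≤y , _) = antisym (bound x≤y) (modular-inequality m x≤y)

  leftModularIn⇒at : LeftModularIn u v m → u ≤ x → x ≤ y → y ≤ v → LeftModularAt m x y
  leftModularIn⇒at {m = m} {x} {y} m-lm u≤x x≤y y≤v with x ≈? y
  ... | yes x≈y = begin
    (x ∨ m) ∧ y  ≤⟨ x∧y≤y _ y ⟩
    y            ≈⟨ Eq.sym x≈y ⟩
    x            ≤⟨ x≤x∨y x _ ⟩
    x ∨ (m ∧ y)  ∎
  ... | no x≉y = reflexive (m-lm x y u≤x y≤v (x≤y , x≉y))

  leftModular⇒at : LeftModular m → x ≤ y → LeftModularAt m x y
  leftModular⇒at m-lm x≤y = leftModularIn⇒at (λ x y _ _ → m-lm x y) (minimum _) x≤y (maximum _)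

  leftModular-resp-≈ : m ≈ m′ → LeftModular m → LeftModular m′
  leftModular-resp-≈ {m} {m′} m≈m′ m-lm = at⇒leftModular λ {x} {y} x≤y → begin
    (x ∨ m′) ∧ y  ≈⟨ ∧-cong (∨-cong Eq.refl (Eq.sym m≈m′)) Eq.refl ⟩
    (x ∨ m) ∧ y   ≤⟨ leftModular⇒at m-lm x≤y ⟩
    x ∨ (m ∧ y)   ≈⟨ ∨-cong Eq.refl (∧-cong m≈m′ Eq.refl) ⟩
    x ∨ (m′ ∧ y)  ∎

  ⊤-leftModular : LeftModular ⊤
  ⊤-leftModular = at⇒leftModular λ {x} {y} _ → begin
    (x ∨ ⊤) ∧ y  ≤⟨ x∧y≤y _ y ⟩
    y            ≤⟨ ∧-greatest (maximum y) refl ⟩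
    ⊤ ∧ y        ≤⟨ y≤x∨y x _ ⟩
    x ∨ (⊤ ∧ y)  ∎

  leftModular⇒leftModularIn : LeftModular m → LeftModularIn u v ((u ∨ m) ∧ v)
  leftModular⇒leftModularIn {m} {u} {v} m-lm x y u≤x y≤v (x≤y , _) = antisym (begin
    (x ∨ ((u ∨ m) ∧ v)) ∧ y  ≤⟨ ∧-monotonic (∨-least (x≤x∨y x m) (trans (x∧y≤x _ v) (∨-monotonic u≤x refl))) refl ⟩
    (x ∨ m) ∧ y              ≤⟨ leftModular⇒at m-lm x≤y ⟩
    x ∨ (m ∧ y)              ≤⟨ ∨-monotonic refl (∧-greatest m∧y≤[u∨m]∧v (x∧y≤y m y)) ⟩
    x ∨ (((u ∨ m) ∧ v) ∧ y)  ∎)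
    (modular-inequality _ x≤y)
    where
    m∧y≤[u∨m]∧v : m ∧ y ≤ (u ∨ m) ∧ v
    m∧y≤[u∨m]∧v = ∧-greatest (trans (x∧y≤x m y) (y≤x∨y u m)) (trans (x∧y≤y m y) y≤v)

  M≰x∨m⇒leftModularAt : LeftModular M → m ⋖ M → ¬ M ≤ x ∨ m → x ≤ y → LeftModularAt m x y
  M≰x∨m⇒leftModularAt {M} {m} {x} {y} M-lm m⋖M M≰x∨m x≤y = begin
    lhs              ≤⟨ ∧-greatest (trans (x∧y≤x _ y) (∨-monotonic (x≤x∨y x _) (⋖⇒≤ m⋖M))) refl ⟩
    (rhs ∨ M) ∧ lhs  ≤⟨ leftModular⇒at M-lm (modular-inequality m x≤y) ⟩
    rhs ∨ (M ∧ lhs)  ≤⟨ ∨-least refl M∧lhs≤rhs ⟩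
    rhs              ∎
    where
    lhs = (x ∨ m) ∧ y
    rhs = x ∨ (m ∧ y)
    [x∨m]∧M≤m : (x ∨ m) ∧ M ≤ m
    [x∨m]∧M≤m with ⋖-between m⋖M (∧-greatest (y≤x∨y x m) (⋖⇒≤ m⋖M)) (x∧y≤y (x ∨ m) M)
    ... | inj₁ [x∨m]∧M≈m = reflexive [x∨m]∧M≈m
    ... | inj₂ [x∨m]∧M≈M = ⊥-elim (M≰x∨m (trans (reflexive (Eq.sym [x∨m]∧M≈M)) (x∧y≤x _ M)))
    M∧lhs≤rhs : M ∧ lhs ≤ rhs
    M∧lhs≤rhs = begin
      M ∧ lhs              ≤⟨ ∧-greatest (∧-greatest (trans (x∧y≤y M lhs) (x∧y≤x _ y)) (x∧y≤x M lhs)) (x∧y≤y M lhs) ⟩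
      ((x ∨ m) ∧ M) ∧ lhs  ≤⟨ ∧-monotonic [x∨m]∧M≤m (x∧y≤y _ y) ⟩
      m ∧ y                ≤⟨ y≤x∨y x _ ⟩
      rhs                  ∎

  infixr 5 _∷_ _∷ʳ_

  data Chain : Carrier → Carrier → ℕ → Set (c ⊔ ℓ₁ ⊔ ℓ₂) where
    []  : p ≈ q → Chain p q 0
    _∷_ : p ⋖ r → Chain r q n → Chain p q (suc n)

  Chain⇒≤ : Chain p q n → p ≤ q
  Chain⇒≤ ([] p≈q)    = reflexive p≈q
  Chain⇒≤ (p⋖r ∷ r→q) = trans (⋖⇒≤ p⋖r) (Chain⇒≤ r→q)

  Chain-≉ : Chain p q (suc n) → ¬ p ≈ q
  Chain-≉ (p⋖r ∷ r→q) p≈q = ⋖⇒≉ p⋖r (antisym (⋖⇒≤ p⋖r) (trans (Chain⇒≤ r→q) (reflexive (Eq.sym p≈q))))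

  Chain-respˡ-≈ : p ≈ p′ → Chain p q n → Chain p′ q n
  Chain-respˡ-≈ p≈p′ ([] p≈q)    = [] (Eq.trans (Eq.sym p≈p′) p≈q)
  Chain-respˡ-≈ p≈p′ (p⋖r ∷ r→q) = ⋖-respˡ-≈ p≈p′ p⋖r ∷ r→q

  Chain-respʳ-≈ : q ≈ q′ → Chain p q n → Chain p q′ n
  Chain-respʳ-≈ q≈q′ ([] p≈q)    = [] (Eq.trans p≈q q≈q′)
  Chain-respʳ-≈ q≈q′ (p⋖r ∷ r→q) = p⋖r ∷ Chain-respʳ-≈ q≈q′ r→q

  _∷ʳ_ : Chain p q n → q ⋖ r → Chain p r (suc n)
  [] p≈q      ∷ʳ q⋖r = ⋖-respˡ-≈ (Eq.sym p≈q) q⋖r ∷ [] Eq.refl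
  (p⋖s ∷ s→q) ∷ʳ q⋖r = p⋖s ∷ (s→q ∷ʳ q⋖r)

  Every : ∀ {ℓ} → (Carrier → Set ℓ) → Chain p q n → Set ℓ
  Every {p = p} P ([] _)   = P p
  Every {p = p} P (_ ∷ ch) = P p × Every P ch

  Every-∷ʳ : ∀ {ℓ} {P : Carrier → Set ℓ} (ch : Chain p q n) (q⋖r : q ⋖ r) →
             Every P ch → P r → Every P (ch ∷ʳ q⋖r)
  Every-∷ʳ ([] _)   _   Pp         Pr = Pp , Pr
  Every-∷ʳ (_ ∷ ch) q⋖r (Pp , Pch) Pr = Pp , Every-∷ʳ ch q⋖r Pch Pr

  element : Chain p q n → Fin (suc n) → Carrier
  element {p = p} _ zero   = p
  element ([] _)   (suc ())
  element (_ ∷ ch) (suc i) = element ch i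

  element-⋖ : (ch : Chain p q n) (i : Fin n) → element ch (inject₁ i) ⋖ element ch (suc i)
  element-⋖ (p⋖r ∷ _) zero    = p⋖r
  element-⋖ (_ ∷ ch)  (suc i) = element-⋖ ch i

  element-last : (ch : Chain p q n) → element ch (fromℕ n) ≈ q
  element-last ([] p≈q) = p≈q
  element-last (_ ∷ ch) = element-last ch

  Every⇒element : ∀ {ℓ} {P : Carrier → Set ℓ} (ch : Chain p q n) → Every P ch → ∀ i → P (element ch i)
  Every⇒element ([] _)   Pp        zero    = Pp
  Every⇒element (_ ∷ _)  (Pp , _)  zero    = Pp
  Every⇒element (_ ∷ ch) (_ , Pch) (suc i) = Every⇒element ch Pch i

  toMaxChain : Chain ⊥ ⊤ n → MaxChain L n
  toMaxChain ch = element ch , Eq.refl , element-last ch , element-⋖ ch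

  fromCovers : ∀ n (f : Fin (suc n) → Carrier) → (∀ i → f (inject₁ i) ⋖ f (suc i)) →
               Chain (f zero) (f (fromℕ n)) n
  fromCovers zero    f _     = [] Eq.refl
  fromCovers (suc n) f cover = cover zero ∷ fromCovers n (f ∘ suc) (cover ∘ suc)

  fromMaxChain : MaxChain L n → Chain ⊥ ⊤ n
  fromMaxChain {n} (f , f₀≈⊥ , fₙ≈⊤ , cover) =
    Chain-respˡ-≈ f₀≈⊥ (Chain-respʳ-≈ fₙ≈⊤ (fromCovers n f cover))

  module Semimodularity (semimodular : Semimodular L) where

    join-⋖ : a ⋖ r → ∀ b → b ∨ a ⋖ b ∨ r ⊎ b ∨ a ≈ b ∨ r
    join-⋖ {a} {r} a⋖r b with ⋖-between a⋖r (∧-greatest (⋖⇒≤ a⋖r) (y≤x∨y b a)) (x∧y≤x r (b ∨ a))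
    ... | inj₁ r∧[b∨a]≈a =
      inj₁ (⋖-respʳ-≈ r∨[b∨a]≈b∨r (semimodular r (b ∨ a) (⋖-respˡ-≈ (Eq.sym r∧[b∨a]≈a) a⋖r)))
      where
      r∨[b∨a]≈b∨r : r ∨ (b ∨ a) ≈ b ∨ r
      r∨[b∨a]≈b∨r = antisym (∨-least (y≤x∨y b r) (∨-monotonic refl (⋖⇒≤ a⋖r)))
                            (∨-least (trans (x≤x∨y b a) (y≤x∨y r _)) (x≤x∨y r _))
    ... | inj₂ r∧[b∨a]≈r = inj₂ (antisym (∨-monotonic refl (⋖⇒≤ a⋖r)) (∨-least (x≤x∨y b a) r≤b∨a))
      where
      r≤b∨a : r ≤ b ∨ a
      r≤b∨a = trans (reflexive (Eq.sym r∧[b∨a]≈r)) (x∧y≤y r _)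

    ⋖-diamond : p ⋖ a → p ⋖ b → ¬ a ≈ b → a ⋖ b ∨ a
    ⋖-diamond p⋖a p⋖b a≉b = semimodular _ _ (⋖-respˡ-≈ (Eq.sym (⋖-meet p⋖b p⋖a (a≉b ∘ Eq.sym))) p⋖b)

    chain-join : Chain a q n → ∀ b → ∃ λ k → Chain (b ∨ a) (b ∨ q) k
    chain-join ([] a≈q) b = 0 , [] (∨-cong Eq.refl a≈q)
    chain-join (a⋖r ∷ r→q) b with chain-join r→q b | join-⋖ a⋖r b
    ... | k , b∨r→b∨q | inj₁ b∨a⋖b∨r = suc k , b∨a⋖b∨r ∷ b∨r→b∨q
    ... | k , b∨r→b∨q | inj₂ b∨a≈b∨r = k , Chain-respˡ-≈ (Eq.sym b∨a≈b∨r) b∨r→b∨q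

    chain-length-unique : ∀ n → Chain p q n → Chain p q k → n ≡ k
    chain-length-unique zero    ([] _)   ([] _)          = ≡.refl
    chain-length-unique zero    ([] p≈q) p→q@(_ ∷ _)     = ⊥-elim (Chain-≉ p→q p≈q)
    chain-length-unique (suc n) p→q      ([] p≈q)        = ⊥-elim (Chain-≉ p→q p≈q)
    chain-length-unique (suc n) (_∷_ {r = a} p⋖a a→q) (_∷_ {r = b} p⋖b b→q) with a ≈? b
    ... | yes a≈b = ≡.cong suc (chain-length-unique n a→q (Chain-respˡ-≈ (Eq.sym a≈b) b→q))
    ... | no a≉b with chain-join a→q b
    ...   | j , b∨a→b∨q = ≡.cong suc (chain-length-unique n b→q′ b→q)
      where
      b∨a→q : Chain (b ∨ a) _ j
      b∨a→q = Chain-respʳ-≈ (x≤y⇒x∨y≈y (Chain⇒≤ b→q)) b∨a→b∨q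
      n≡1+j : n ≡ suc j
      n≡1+j = chain-length-unique n a→q (⋖-diamond p⋖a p⋖b a≉b ∷ b∨a→q)
      b→q′ : Chain b _ n
      b→q′ = ≡.subst (Chain b _) (≡.sym n≡1+j)
               (⋖-respʳ-≈ (∨-comm a b) (⋖-diamond p⋖b p⋖a (a≉b ∘ Eq.sym)) ∷ b∨a→q)

    graded : Graded L
    graded n k ch ch′ = chain-length-unique n (fromMaxChain ch) (fromMaxChain ch′)

    join-stays-below : LeftModular M → m ≤ M → s ⋖ t → M ∧ t ≤ s → ¬ M ≤ m ∨ s → ¬ M ≤ m ∨ t
    join-stays-below {M} {m} {s} {t} M-lm m≤M s⋖t M∧t≤s M≰m∨s M≤m∨t with join-⋖ s⋖t m
    ... | inj₂ m∨s≈m∨t = M≰m∨s (trans M≤m∨t (reflexive (Eq.sym m∨s≈m∨t)))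
    ... | inj₁ m∨s⋖m∨t with ⋖-between m∨s⋖m∨t (∨-least (trans m≤M (y≤x∨y s M)) (x≤x∨y s M))
                                              (∨-least (trans (⋖⇒≤ s⋖t) (y≤x∨y m t)) M≤m∨t)
    ...   | inj₁ s∨M≈m∨s = M≰m∨s (trans (y≤x∨y s M) (reflexive s∨M≈m∨s))
    ...   | inj₂ s∨M≈m∨t = ⋖⇒≉ s⋖t (antisym (⋖⇒≤ s⋖t) t≤s)
      where
      t≤s : t ≤ s
      t≤s = begin
        t            ≤⟨ ∧-greatest (trans (y≤x∨y m t) (reflexive (Eq.sym s∨M≈m∨t))) refl ⟩
        (s ∨ M) ∧ t  ≤⟨ leftModular⇒at M-lm (⋖⇒≤ s⋖t) ⟩
        s ∨ (M ∧ t)  ≤⟨ ∨-least refl M∧t≤s ⟩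
        s            ∎

    join-stays-below-along : LeftModular M → m ≤ M → Chain s x n → x ∧ M ≤ s → ¬ M ≤ m ∨ s → ¬ M ≤ m ∨ x
    join-stays-below-along _ _ ([] s≈x) _ M≰m∨s M≤m∨x =
      M≰m∨s (trans M≤m∨x (reflexive (∨-cong Eq.refl (Eq.sym s≈x))))
    join-stays-below-along {M} {s = s} {x} M-lm m≤M (_∷_ {r = t} s⋖t t→x) x∧M≤s M≰m∨s =
      join-stays-below-along M-lm m≤M t→x (trans x∧M≤s (⋖⇒≤ s⋖t))
        (join-stays-below M-lm m≤M s⋖t M∧t≤s M≰m∨s)
      where
      M∧t≤s : M ∧ t ≤ s
      M∧t≤s = trans (∧-greatest (trans (x∧y≤y M t) (Chain⇒≤ t→x)) (x∧y≤x M t)) x∧M≤s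

    projection-⋖ : u ≤ v → LeftModular m → m ⋖ m′ →
                   ¬ (u ∨ m) ∧ v ≈ v → (u ∨ m′) ∧ v ≈ v → (u ∨ m) ∧ v ⋖ v
    projection-⋖ {u} {v} {m} {m′} u≤v m-lm m⋖m′ [u∨m]∧v≉v [u∨m′]∧v≈v =
      ⋖-intro (x∧y≤y _ v , [u∨m]∧v≉v) collapse
      where
      v≤u∨m′ : v ≤ u ∨ m′
      v≤u∨m′ = trans (reflexive (Eq.sym [u∨m′]∧v≈v)) (x∧y≤x _ v)
      collapse : ∀ {z} → (u ∨ m) ∧ v ≤ z → z ≤ v → z ≤ (u ∨ m) ∧ v ⊎ v ≤ z
      collapse {z} [u∨m]∧v≤z z≤v with join-⋖ m⋖m′ u
      ... | inj₂ u∨m≈u∨m′ = inj₁ (∧-greatest (trans z≤v (trans v≤u∨m′ (reflexive (Eq.sym u∨m≈u∨m′)))) z≤v)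
      ... | inj₁ u∨m⋖u∨m′ with ⋖-between u∨m⋖u∨m′ (x≤x∨y _ z)
                                 (∨-least (∨-monotonic refl (⋖⇒≤ m⋖m′)) (trans z≤v v≤u∨m′))
      ...   | inj₁ [u∨m]∨z≈u∨m  = inj₁ (∧-greatest (trans (y≤x∨y _ z) (reflexive [u∨m]∨z≈u∨m)) z≤v)
      ...   | inj₂ [u∨m]∨z≈u∨m′ = inj₂ (begin
        v            ≤⟨ ∧-greatest v≤z∨m refl ⟩
        (z ∨ m) ∧ v  ≤⟨ leftModular⇒at m-lm z≤v ⟩
        z ∨ (m ∧ v)  ≤⟨ ∨-least refl (trans (∧-monotonic (y≤x∨y u m) refl) [u∨m]∧v≤z) ⟩
        z            ∎)
        where
        u≤z : u ≤ z
        u≤z = trans (∧-greatest (x≤x∨y u m) u≤v) [u∨m]∧v≤z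
        v≤z∨m : v ≤ z ∨ m
        v≤z∨m = begin
          v              ≤⟨ v≤u∨m′ ⟩
          u ∨ m′         ≈⟨ Eq.sym [u∨m]∨z≈u∨m′ ⟩
          (u ∨ m) ∨ z    ≤⟨ ∨-least (∨-monotonic u≤z refl) (x≤x∨y z m) ⟩
          z ∨ m          ∎

    coatom-search : u ≤ v → ∀ n (f : Fin (suc n) → Carrier) →
                    (∀ i → f (inject₁ i) ⋖ f (suc i)) → (∀ i → LeftModular (f i)) →
                    ¬ (u ∨ f zero) ∧ v ≈ v → (u ∨ f (fromℕ n)) ∧ v ≈ v →
                    ∃ λ q → u ≤ q × q ⋖ v × LeftModularIn u v q
    coatom-search _ zero _ _ _ bottom≉v top≈v = ⊥-elim (bottom≉v top≈v)
    coatom-search {u} {v} u≤v (suc n) f cover lm bottom≉v top≈v with (u ∨ f (suc zero)) ∧ v ≈? v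
    ... | yes next≈v = (u ∨ f zero) ∧ v , ∧-greatest (x≤x∨y u _) u≤v ,
                       projection-⋖ u≤v (lm zero) (cover zero) bottom≉v next≈v ,
                       leftModular⇒leftModularIn (lm zero)
    ... | no next≉v = coatom-search u≤v n (f ∘ suc) (cover ∘ suc) (lm ∘ suc) next≉v top≈v

    supersolvable⇒comodernistic : Supersolvable L → Comodernistic L
    supersolvable⇒comodernistic (_ , n , (f , f₀≈⊥ , fₙ≈⊤ , cover) , lm) u v (u≤v , u≉v) =
      coatom-search u≤v n f cover lm bottom≉v top≈v
      where
      bottom≉v : ¬ (u ∨ f zero) ∧ v ≈ v
      bottom≉v [u∨f₀]∧v≈v = u≉v (antisym u≤v (begin
        v                 ≈⟨ Eq.sym [u∨f₀]∧v≈v ⟩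
        (u ∨ f zero) ∧ v  ≤⟨ x∧y≤x _ v ⟩
        u ∨ f zero        ≤⟨ ∨-least refl (trans (reflexive f₀≈⊥) (minimum u)) ⟩
        u                 ∎))
      top≈v : (u ∨ f (fromℕ n)) ∧ v ≈ v
      top≈v = antisym (x∧y≤y _ v) (∧-greatest (trans (maximum v) (trans (reflexive (Eq.sym fₙ≈⊤)) (y≤x∨y u _))) refl)

  module GeometricLattice (semimodular : Semimodular L) (atomistic : Atomistic L) where
    open Semimodularity semimodular

    chain-to-join-of-atoms : ∀ {as} → All IsAtom as → ∃ λ n → Chain ⊥ (foldr _∨_ ⊥ as) n
    chain-to-join-of-atoms [] = 0 , [] Eq.refl
    chain-to-join-of-atoms {a ∷ _} (⊥⋖a ∷ atoms) with chain-to-join-of-atoms atoms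
    ... | _ , ⊥→⋁as with chain-join ⊥→⋁as a
    ...   | k , a∨⊥→a∨⋁as = suc k , ⊥⋖a ∷ Chain-respˡ-≈ (identityʳ a) a∨⊥→a∨⋁as

    chain-exists : p ≤ x → ∃ λ n → Chain p x n
    chain-exists {p} {x} p≤x with atomistic x
    ... | as , atoms , ⋁as≈x with chain-to-join-of-atoms atoms
    ...   | _ , ⊥→⋁as with chain-join ⊥→⋁as p
    ...     | k , p∨⊥→p∨⋁as =
      k , Chain-respˡ-≈ (identityʳ p) (Chain-respʳ-≈ (Eq.trans (∨-cong Eq.refl ⋁as≈x) (x≤y⇒x∨y≈y p≤x)) p∨⊥→p∨⋁as)

    cover-not-below-join : LeftModular M → m ⋖ M → x ∧ M ≤ m → ¬ M ≤ x ∨ m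
    cover-not-below-join {M} {m} {x} M-lm m⋖M x∧M≤m M≤x∨m =
      join-stays-below-along M-lm (⋖⇒≤ m⋖M) (proj₂ (chain-exists (x∧y≤x x M))) refl M≰m∨[x∧M]
        (trans M≤x∨m (reflexive (∨-comm x m)))
      where
      M≰m∨[x∧M] : ¬ M ≤ m ∨ (x ∧ M)
      M≰m∨[x∧M] M≤m∨[x∧M] = ⋖⇒≉ m⋖M (antisym (⋖⇒≤ m⋖M) (trans M≤m∨[x∧M] (∨-least refl x∧M≤m)))

    M≤x∨m⇒leftModularAt : LeftModular M → m ⋖ M → LeftModularIn ⊥ M m → M ≤ x ∨ m → x ≤ y →
                          LeftModularAt m x y
    M≤x∨m⇒leftModularAt {M} {m} {x} {y} M-lm m⋖M m-lmIn M≤x∨m x≤y = begin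
      (x ∨ m) ∧ y  ≤⟨ ∧-monotonic (∨-monotonic refl m≤M) refl ⟩
      (x ∨ M) ∧ y  ≤⟨ leftModular⇒at M-lm x≤y ⟩
      x ∨ (M ∧ y)  ≤⟨ ∨-least (x≤x∨y x _) M∧y≤x∨[m∧y] ⟩
      x ∨ (m ∧ y)  ∎
      where
      m≤M : m ≤ M
      m≤M = ⋖⇒≤ m⋖M
      M≤[x∧M]∨m : M ≤ (x ∧ M) ∨ m
      M≤[x∧M]∨m with ⋖-between m⋖M (y≤x∨y (x ∧ M) m) (∨-least (x∧y≤y x M) m≤M)
      ... | inj₁ [x∧M]∨m≈m =
        ⊥-elim (cover-not-below-join M-lm m⋖M (trans (x≤x∨y _ m) (reflexive [x∧M]∨m≈m)) M≤x∨m)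
      ... | inj₂ [x∧M]∨m≈M = reflexive (Eq.sym [x∧M]∨m≈M)
      M∧y≤x∨[m∧y] : M ∧ y ≤ x ∨ (m ∧ y)
      M∧y≤x∨[m∧y] = begin
        M ∧ y                    ≤⟨ ∧-greatest (trans (x∧y≤x M y) M≤[x∧M]∨m) refl ⟩
        ((x ∧ M) ∨ m) ∧ (M ∧ y)  ≤⟨ leftModularIn⇒at m-lmIn (minimum _)
                                      (∧-greatest (x∧y≤y x M) (trans (x∧y≤x x M) x≤y)) (x∧y≤x M y) ⟩
        (x ∧ M) ∨ (m ∧ (M ∧ y))  ≤⟨ ∨-monotonic (x∧y≤x x M) (∧-monotonic refl (x∧y≤y M y)) ⟩
        x ∨ (m ∧ y)              ∎

    leftModular-below-cover : LeftModular M → m ⋖ M → LeftModularIn ⊥ M m → LeftModular m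
    leftModular-below-cover {M} {m} M-lm m⋖M m-lmIn = at⇒leftModular bound
      where
      bound : ∀ {x y} → x ≤ y → LeftModularAt m x y
      bound {x} x≤y with M ≤? (x ∨ m)
      ... | yes M≤x∨m = M≤x∨m⇒leftModularAt M-lm m⋖M m-lmIn M≤x∨m x≤y
      ... | no M≰x∨m  = M≰x∨m⇒leftModularAt M-lm m⋖M M≰x∨m x≤y

    leftModular-down-chain : ∀ n (f : Fin (suc n) → Carrier) → (∀ i → f (inject₁ i) ⋖ f (suc i)) →
                             LeftModular (f (fromℕ n)) → (∀ i → LeftModularIn ⊥ (f (suc i)) (f (inject₁ i))) →
                             ∀ i → LeftModular (f i)
    leftModular-down-chain zero    _ _     top-lm _   zero    = top-lm
    leftModular-down-chain (suc n) f cover top-lm sub zero    =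
      leftModular-below-cover (leftModular-down-chain n (f ∘ suc) (cover ∘ suc) top-lm (sub ∘ suc) zero)
                              (cover zero) (sub zero)
    leftModular-down-chain (suc n) f cover top-lm sub (suc i) =
      leftModular-down-chain n (f ∘ suc) (cover ∘ suc) top-lm (sub ∘ suc) i

    subMChain⇒MChain : ∀ n (ch : MaxChain L n) → IsSubMChain L ch → IsMChain L ch
    subMChain⇒MChain n (f , _ , fₙ≈⊤ , cover) =
      leftModular-down-chain n f cover (leftModular-resp-≈ (Eq.sym fₙ≈⊤) ⊤-leftModular)

    leftModularChain : Comodernistic L → ∀ k → LeftModular v → Chain ⊥ v k →
                       Σ (Chain ⊥ v k) (Every LeftModular)
    leftModularChain _ zero v-lm ([] ⊥≈v) = [] ⊥≈v , leftModular-resp-≈ (Eq.sym ⊥≈v) v-lm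
    leftModularChain {v} comodernistic (suc k) v-lm ⊥→v
      with comodernistic ⊥ v (minimum v , Chain-≉ ⊥→v)
    ... | m , _ , m⋖v , m-lmIn with chain-exists (minimum m)
    ...   | j , ⊥→m with chain-length-unique (suc k) ⊥→v (⊥→m ∷ʳ m⋖v)
    ...     | ≡.refl with leftModularChain comodernistic k (leftModular-below-cover v-lm m⋖v m-lmIn) ⊥→m
    ...       | ⊥→m′ , lm = ⊥→m′ ∷ʳ m⋖v , Every-∷ʳ ⊥→m′ m⋖v lm v-lm

    comodernistic⇒supersolvable : Comodernistic L → Supersolvable L
    comodernistic⇒supersolvable comodernistic with chain-exists (minimum ⊤)
    ... | k , ⊥→⊤ with leftModularChain comodernistic k ⊤-leftModular ⊥→⊤
    ...   | mchain , lm = graded , k , toMaxChain mchain , Every⇒element mchain lm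

open DecidableBoundedLattice using (module Semimodularity; module GeometricLattice)

≤-decidable : ∀ {c ℓ₁ ℓ₂} (L : BoundedLattice c ℓ₁ ℓ₂) → IsFinite L → Decidable (BoundedLattice._≤_ L)
≤-decidable _ (_ , _ , _ , _≤?_) = _≤?_

proposition3p8 : ∀ {c ℓ₁ ℓ₂} →
    ((L : BoundedLattice c ℓ₁ ℓ₂) → IsFinite L → Geometric L →
    ∀ n (ch : MaxChain L n) → IsSubMChain L ch → IsMChain L ch)
    ×
    ((L : BoundedLattice c ℓ₁ ℓ₂) → IsFinite L →
    ((Geometric L × Comodernistic L) → (Geometric L × Supersolvable L))
    × ((Geometric L × Supersolvable L) → (Geometric L × Comodernistic L)))
proposition3p8 =
  (λ L finite (semimodular , atomistic) →
     GeometricLattice.subMChain⇒MChain L (≤-decidable L finite) semimodular atomistic) ,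
  λ L finite →
    (λ { (geometric@(semimodular , atomistic) , comodernistic) →
           geometric ,
           GeometricLattice.comodernistic⇒supersolvable L (≤-decidable L finite) semimodular atomistic comodernistic }) ,
    (λ { (geometric@(semimodular , _) , supersolvable) →
           geometric ,
           Semimodularity.supersolvable⇒comodernistic L (≤-decidable L finite) semimodular supersolvable })
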